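{- Let $G$ be a connected graph and $D$ an $r$-critical rooted distribution on $G$ with root $r$. If $a\neq r$ is a vertex of $G$ of degree 1, then $D(a)$ is even.
   Context: A pebbling distribution $D$ assigns to each vertex $a$ a non-negative integer $D(a)$ of pebbles. A pebbling step $[a,b]$, for adjacent $a,b$, removes two pebbles from $a$ and adds one to $b$. A rooted distribution with root $r$ is $r$-solvable if some sequence of pebbling steps ends with at least one pebble on $r$; it is $r$-critical if it is $r$-solvable but removing any single pebble makes it not $r$-solvable. -}

module Defs where

open import Data.Nat using (ℕ; zero; suc; _+_; _∸_; _≤_)
open import Data.Nat.Properties using ()
open import Data.Bool using (Bool; true; false; if_then_else_; T)
open import Data.Fin using (Fin)
open import Data.Fin.Properties using (_≟_)
open import Data.List using (List; filter; length; allFin)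
open import Data.Product using (Σ; ∃; _×_; _,_)
open import Relation.Nullary using (¬_; does)
open import Relation.Binary.PropositionalEquality using (_≡_)
open import Relation.Binary.Construct.Closure.ReflexiveTransitive using (Star)

record Graph : Set where
  field
    n     : ℕ
    adj   : Fin n → Fin n → Bool
    sym   : ∀ a b → adj a b ≡ adj b a
    irrefl : ∀ a → adj a a ≡ false

module _ (G : Graph) where
  open Graph G

  Vertex : Set
  Vertex = Fin n

  Adj : Vertex → Vertex → Set
  Adj a b = T (adj a b)

  degree : Vertex → ℕ
  degree a = length (filter (λ b → T? (adj a b)) (allFin n))
    where
      open import Data.Bool using (T?)

  Connected : Set
  Connected = ∀ (a b : Vertex) → Star Adj a b

  Distribution : Set
  Distribution = Vertex → ℕ

  stepDist : Distribution → Vertex → Vertex → Distribution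
  stepDist D a b x =
    if does (x ≟ a) then D x ∸ 2
    else if does (x ≟ b) then suc (D x)
    else D x

  data PebStep (D : Distribution) : Distribution → Set where
    step : (a b : Vertex) → Adj a b → 2 ≤ D a → PebStep D (stepDist D a b)

  Reaches : Distribution → Distribution → Set
  Reaches = Star PebStep

  Solvable : Vertex → Distribution → Set
  Solvable r D = Σ Distribution λ D' → Reaches D D' × 1 ≤ D' r

  removeOne : Distribution → Vertex → Distribution
  removeOne D v x = if does (x ≟ v) then D x ∸ 1 else D x

  Critical : Vertex → Distribution → Set
  Critical r D = Solvable r D × (∀ v → 1 ≤ D v → ¬ Solvable r (removeOne D v))

-- Pebbles on a leaf a leave only towards its unique neighbour b, two at a time. Precisely: every pebbling sequence from D is simulated by one from
-- D with that pebble removed, keeping the invariant that the simulator has at least as many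
-- pebbles on every vertex other than a and at least the same reserve E(b) + ⌊E(a)/2⌋.
module Submission where

open import Defs
open import Level using (0ℓ)
open import Data.Nat using (ℕ; zero; suc; _+_; _∸_; _≤_; z≤n; s≤s; _≤?_; ⌊_/2⌋)
open import Data.Nat.Properties
  using (≤-trans; ≤-reflexive; ≤-antisym; ≤-pred; ≰⇒>; n≤1+n; n≢0⇒n>0; +-suc;
         +-monoʳ-≤; +-cancelˡ-≤; +-∸-comm; ∸-monoˡ-≤; m∸n≤m; ⌊n/2⌋-mono)
open import Data.Nat.Divisibility using (_∣_; _∣?_; ∣-refl; _∣0; ∣m∣n⇒∣m+n)
open import Data.Bool using (T; T?)
open import Data.Fin.Properties using (_≟_)
open import Data.List using (List; []; _∷_; filter; length; allFin)
open import Data.List.Membership.Propositional using (_∈_)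
open import Data.List.Membership.Propositional.Properties using (∈-filter⁺; ∈-filter⁻; ∈-allFin)
open import Data.List.Relation.Unary.Any using (here)
open import Data.Product using (∃; _×_; _,_; proj₂)
open import Function using (_∘_)
open import Relation.Nullary using (¬_; yes; no; contradiction)
open import Relation.Nullary.Decidable using (dec-true; dec-false)
open import Relation.Unary using (Pred; Decidable)
open import Relation.Binary using (Rel)
open import Relation.Binary.PropositionalEquality
  using (_≡_; _≢_; refl; sym; trans; cong; cong₂; subst; subst₂; module ≡-Reasoning)
open import Relation.Binary.Construct.Closure.ReflexiveTransitive using (Star; ε; _◅_; _◅◅_)

⌊n∸1/2⌋≡⌊n/2⌋ : ∀ n → ¬ 2 ∣ n → ⌊ n ∸ 1 /2⌋ ≡ ⌊ n /2⌋
⌊n∸1/2⌋≡⌊n/2⌋ zero                n-odd = contradiction (2 ∣0) n-odd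
⌊n∸1/2⌋≡⌊n/2⌋ (suc zero)          _     = refl
⌊n∸1/2⌋≡⌊n/2⌋ (suc (suc zero))    n-odd = contradiction ∣-refl n-odd
⌊n∸1/2⌋≡⌊n/2⌋ (suc (suc (suc k))) n-odd =
  cong suc (⌊n∸1/2⌋≡⌊n/2⌋ (suc k) (n-odd ∘ ∣m∣n⇒∣m+n ∣-refl))

1+⌊n∸2/2⌋≡⌊n/2⌋ : ∀ {n} → 2 ≤ n → suc ⌊ n ∸ 2 /2⌋ ≡ ⌊ n /2⌋
1+⌊n∸2/2⌋≡⌊n/2⌋ (s≤s (s≤s _)) = refl

⌊1+n/2⌋≤1+⌊n/2⌋ : ∀ n → ⌊ suc n /2⌋ ≤ suc ⌊ n /2⌋
⌊1+n/2⌋≤1+⌊n/2⌋ zero          = z≤n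
⌊1+n/2⌋≤1+⌊n/2⌋ (suc zero)    = s≤s z≤n
⌊1+n/2⌋≤1+⌊n/2⌋ (suc (suc n)) = s≤s (⌊1+n/2⌋≤1+⌊n/2⌋ n)

1≤⌊n/2⌋⇒2≤n : ∀ {n} → 1 ≤ ⌊ n /2⌋ → 2 ≤ n
1≤⌊n/2⌋⇒2≤n {suc (suc _)} (s≤s _) = s≤s (s≤s z≤n)

m∸2+k≤m+h : ∀ {m k h} → 2 ≤ m → k ≤ suc h → m ∸ 2 + k ≤ m + h
m∸2+k≤m+h {suc (suc m)} {k} {h} (s≤s (s≤s _)) k≤1+h =
  ≤-trans (+-monoʳ-≤ m k≤1+h) (≤-trans (≤-reflexive (+-suc m h)) (n≤1+n _))

m∸2+h≤n∸2+h′ : ∀ {m n h h′} → 2 ≤ m → 2 ≤ n → m + h ≤ n + h′ → m ∸ 2 + h ≤ n ∸ 2 + h′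
m∸2+h≤n∸2+h′ {h = h} {h′} 2≤m 2≤n le =
  subst₂ _≤_ (+-∸-comm h 2≤m) (+-∸-comm h′ 2≤n) (∸-monoˡ-≤ 2 le)

length-filter≡1⇒unique : ∀ {A : Set} {P : Pred A 0ℓ} (P? : Decidable P) (xs : List A) →
  length (filter P? xs) ≡ 1 → ∃ λ b → P b × (∀ {y} → y ∈ xs → P y → y ≡ b)
length-filter≡1⇒unique P? xs _ with filter P? xs in eq
... | b ∷ [] =
  b , proj₂ (∈-filter⁻ P? {xs = xs} (subst (b ∈_) (sym eq) (here refl))) ,
  λ y∈xs Py → singleton (subst (_ ∈_) eq (∈-filter⁺ P? y∈xs Py))
  where
    singleton : ∀ {y} → y ∈ b ∷ [] → y ≡ b
    singleton (here y≡b) = y≡b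

Star-simulation : ∀ {a ℓ₁ ℓ₂} {A : Set a} {_⟶_ : Rel A ℓ₁} (_≼_ : Rel A ℓ₂) →
  (∀ {E E′ F} → E ⟶ E′ → E ≼ F → ∃ λ F′ → Star _⟶_ F F′ × E′ ≼ F′) →
  ∀ {E E′ F} → Star _⟶_ E E′ → E ≼ F → ∃ λ F′ → Star _⟶_ F F′ × E′ ≼ F′
Star-simulation _≼_ simulate ε        E≼F = _ , ε , E≼F
Star-simulation _≼_ simulate (s ◅ ss) E≼F with simulate s E≼F
... | F₁ , F⟶*F₁ , E₁≼F₁ with Star-simulation _≼_ simulate ss E₁≼F₁
...   | F₂ , F₁⟶*F₂ , E₂≼F₂ = F₂ , F⟶*F₁ ◅◅ F₁⟶*F₂ , E₂≼F₂

module _ (G : Graph) where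

  Adj⇒≢ : ∀ {x y} → Adj G x y → x ≢ y
  Adj⇒≢ {x} x-y refl = subst T (Graph.irrefl G x) x-y

  Adj-sym : ∀ {x y} → Adj G x y → Adj G y x
  Adj-sym {x} {y} = subst T (Graph.sym G x y)

  degree≡1⇒unique-neighbour : ∀ a → degree G a ≡ 1 →
    ∃ λ b → Adj G a b × (∀ {y} → Adj G a y → y ≡ b)
  degree≡1⇒unique-neighbour a deg
    with length-filter≡1⇒unique (λ b → T? (Graph.adj G a b)) (allFin (Graph.n G)) deg
  ... | b , a-b , unique = b , a-b , unique (∈-allFin _)

  stepDist-source : ∀ D x y → stepDist G D x y x ≡ D x ∸ 2
  stepDist-source D x y rewrite dec-true (x ≟ x) refl = refl

  stepDist-target : ∀ D {x y} → x ≢ y → stepDist G D x y y ≡ suc (D y)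
  stepDist-target D {x} {y} x≢y rewrite dec-false (y ≟ x) (x≢y ∘ sym) | dec-true (y ≟ y) refl = refl

  stepDist-other : ∀ D {x y z} → z ≢ x → z ≢ y → stepDist G D x y z ≡ D z
  stepDist-other D {x} {y} {z} z≢x z≢y rewrite dec-false (z ≟ x) z≢x | dec-false (z ≟ y) z≢y = refl

  stepDist-mono : ∀ E F x y z → E z ≤ F z → stepDist G E x y z ≤ stepDist G F x y z
  stepDist-mono E F x y z le with z ≟ x
  ... | yes _ = ∸-monoˡ-≤ 2 le
  ... | no _ with z ≟ y
  ...   | yes _ = s≤s le
  ...   | no _  = le

  removeOne-here : ∀ D v → removeOne G D v v ≡ D v ∸ 1
  removeOne-here D v rewrite dec-true (v ≟ v) refl = refl

  removeOne-other : ∀ D {v z} → z ≢ v → removeOne G D v z ≡ D z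
  removeOne-other D {v} {z} z≢v rewrite dec-false (z ≟ v) z≢v = refl

module Pendant (G : Graph) {a b : Vertex G} (a-b : Adj G a b) (only-b : ∀ {y} → Adj G a y → y ≡ b) where

  b≢a : b ≢ a
  b≢a = Adj⇒≢ G a-b ∘ sym

  reserve : Distribution G → ℕ
  reserve E = E b + ⌊ E a /2⌋

  record _≼_ (E F : Distribution G) : Set where
    constructor dominated
    field
      away      : ∀ z → z ≢ a → E z ≤ F z
      reserve-≤ : reserve E ≤ reserve F
  open _≼_

  reserve-step-out : ∀ E → 2 ≤ E a → reserve (stepDist G E a b) ≡ reserve E
  reserve-step-out E 2≤Ea = begin
    stepDist G E a b b + ⌊ stepDist G E a b a /2⌋
      ≡⟨ cong₂ (λ u v → u + ⌊ v /2⌋) (stepDist-target G E (b≢a ∘ sym)) (stepDist-source G E a b) ⟩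
    suc (E b) + ⌊ E a ∸ 2 /2⌋  ≡⟨ sym (+-suc (E b) _) ⟩
    E b + suc ⌊ E a ∸ 2 /2⌋    ≡⟨ cong (E b +_) (1+⌊n∸2/2⌋≡⌊n/2⌋ 2≤Ea) ⟩
    E b + ⌊ E a /2⌋            ∎
    where open ≡-Reasoning

  reserve-step-in : ∀ E → 2 ≤ E b → reserve (stepDist G E b a) ≤ reserve E
  reserve-step-in E 2≤Eb =
    subst (_≤ reserve E)
      (sym (cong₂ (λ u v → u + ⌊ v /2⌋) (stepDist-source G E b a) (stepDist-target G E b≢a)))
      (m∸2+k≤m+h 2≤Eb (⌊1+n/2⌋≤1+⌊n/2⌋ (E a)))

  reserve-step-avoiding : ∀ {E F x y} → x ≢ a → y ≢ a → 2 ≤ E x → 2 ≤ F x →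
    reserve E ≤ reserve F → reserve (stepDist G E x y) ≤ reserve (stepDist G F x y)
  reserve-step-avoiding {E} {F} {x} {y} x≢a y≢a 2≤Ex 2≤Fx le
    rewrite stepDist-other G E (x≢a ∘ sym) (y≢a ∘ sym) | stepDist-other G F (x≢a ∘ sym) (y≢a ∘ sym)
    with b ≟ x
  ... | yes refl = m∸2+h≤n∸2+h′ 2≤Ex 2≤Fx le
  ... | no _ with b ≟ y
  ...   | yes _ = s≤s le
  ...   | no _  = le

  -- F copies the move a → b unless its surplus on b already accounts for it.
  ≼-step-out : ∀ {E F} → 2 ≤ E a → E ≼ F → ∃ λ F′ → Reaches G F F′ × stepDist G E a b ≼ F′
  ≼-step-out {E} {F} 2≤Ea E≼F with suc (E b) ≤? F b
  ... | yes Eb<Fb = F , ε , dominated away′ (subst (_≤ reserve F) (sym (reserve-step-out E 2≤Ea)) (reserve-≤ E≼F))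
    where
      away′ : ∀ z → z ≢ a → stepDist G E a b z ≤ F z
      -- Deciding b ≟ z rather than z ≟ b keeps the with from abstracting inside stepDist.
      away′ z z≢a with b ≟ z
      ... | yes refl = subst (_≤ F b) (sym (stepDist-target G E (b≢a ∘ sym))) Eb<Fb
      ... | no b≢z   = subst (_≤ F z) (sym (stepDist-other G E z≢a (b≢z ∘ sym))) (away E≼F z z≢a)
  ... | no Eb≮Fb =
    stepDist G F a b , step a b a-b 2≤Fa ◅ ε ,
    dominated (λ z z≢a → stepDist-mono G E F a b z (away E≼F z z≢a))
              (subst₂ _≤_ (sym (reserve-step-out E 2≤Ea)) (sym (reserve-step-out F 2≤Fa)) (reserve-≤ E≼F))
    where
      Fb≡Eb : F b ≡ E b
      Fb≡Eb = ≤-antisym (≤-pred (≰⇒> Eb≮Fb)) (away E≼F b b≢a)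
      ⌊Ea/2⌋≤⌊Fa/2⌋ : ⌊ E a /2⌋ ≤ ⌊ F a /2⌋
      ⌊Ea/2⌋≤⌊Fa/2⌋ =
        +-cancelˡ-≤ (E b) _ _ (subst (λ t → E b + ⌊ E a /2⌋ ≤ t + ⌊ F a /2⌋) Fb≡Eb (reserve-≤ E≼F))
      2≤Fa : 2 ≤ F a
      2≤Fa = 1≤⌊n/2⌋⇒2≤n (≤-trans (⌊n/2⌋-mono 2≤Ea) ⌊Ea/2⌋≤⌊Fa/2⌋)

  ≼-step-in : ∀ {E F} → 2 ≤ E b → E ≼ F → stepDist G E b a ≼ F
  ≼-step-in {E} {F} 2≤Eb E≼F = dominated away′ (≤-trans (reserve-step-in E 2≤Eb) (reserve-≤ E≼F))
    where
      away′ : ∀ z → z ≢ a → stepDist G E b a z ≤ F z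
      away′ z z≢a with b ≟ z
      ... | yes refl =
        subst (_≤ F b) (sym (stepDist-source G E b a)) (≤-trans (m∸n≤m (E b) 2) (away E≼F b b≢a))
      ... | no b≢z = subst (_≤ F z) (sym (stepDist-other G E (b≢z ∘ sym) z≢a)) (away E≼F z z≢a)

  ≼-step-avoiding : ∀ {E F x y} → x ≢ a → y ≢ a → 2 ≤ E x → E ≼ F → stepDist G E x y ≼ stepDist G F x y
  ≼-step-avoiding {E} {F} {x} {y} x≢a y≢a 2≤Ex E≼F =
    dominated (λ z z≢a → stepDist-mono G E F x y z (away E≼F z z≢a))
              (reserve-step-avoiding x≢a y≢a 2≤Ex (≤-trans 2≤Ex (away E≼F x x≢a)) (reserve-≤ E≼F))

  ≼-simulates-step : ∀ {E E′ F} → PebStep G E E′ → E ≼ F → ∃ λ F′ → Reaches G F F′ × E′ ≼ F′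
  ≼-simulates-step (step x y x-y 2≤Ex) E≼F with x ≟ a | y ≟ a
  ... | yes refl | _ with only-b x-y
  ...   | refl = ≼-step-out 2≤Ex E≼F
  ≼-simulates-step (step x y x-y 2≤Ex) E≼F | no _ | yes refl with only-b (Adj-sym G x-y)
  ...   | refl = _ , ε , ≼-step-in 2≤Ex E≼F
  ≼-simulates-step (step x y x-y 2≤Ex) E≼F | no x≢a | no y≢a =
    _ , step x y x-y (≤-trans 2≤Ex (away E≼F x x≢a)) ◅ ε , ≼-step-avoiding x≢a y≢a 2≤Ex E≼F

  ≼-removeOne : ∀ {D} → ¬ 2 ∣ D a → D ≼ removeOne G D a
  ≼-removeOne {D} Da-odd =
    dominated (λ z z≢a → ≤-reflexive (sym (removeOne-other G D z≢a)))
              (≤-reflexive (cong₂ _+_ (sym (removeOne-other G D b≢a))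
                                      (sym (trans (cong ⌊_/2⌋ (removeOne-here G D a)) (⌊n∸1/2⌋≡⌊n/2⌋ (D a) Da-odd)))))

  removeOne-preserves-solvable : ∀ {D r} → ¬ 2 ∣ D a → r ≢ a → Solvable G r D → Solvable G r (removeOne G D a)
  removeOne-preserves-solvable {r = r} Da-odd r≢a (D′ , D⟶*D′ , 1≤D′r)
    with Star-simulation _≼_ ≼-simulates-step D⟶*D′ (≼-removeOne Da-odd)
  ... | F′ , reach , D′≼F′ = F′ , reach , ≤-trans 1≤D′r (away D′≼F′ r r≢a)

corollary4 : (G : Graph) → Connected G → (r : Vertex G) → (D : Distribution G) →
    Critical G r D → (a : Vertex G) → ¬ (a ≡ r) → degree G a ≡ 1 → 2 ∣ D a
corollary4 G _ r D (solvable , critical) a a≢r deg-a with 2 ∣? D a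
... | yes Da-even = Da-even
... | no Da-odd with degree≡1⇒unique-neighbour G a deg-a
...   | b , a-b , only-b =
  contradiction (removeOne-preserves-solvable Da-odd (a≢r ∘ sym) solvable) (critical a 1≤Da)
  where
    open Pendant G a-b only-b
    1≤Da : 1 ≤ D a
    1≤Da = n≢0⇒n>0 (λ Da≡0 → Da-odd (subst (2 ∣_) (sym Da≡0) (2 ∣0)))
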